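{- Let $\mathscr{G}$ be a bipartite graph with bipartition sets of sizes $n_1$ and $n_2$, and let $M_1(\mathscr{G})$ be its first Zagreb index. Then \[ \sigma(\mathscr{G})\leq 2M_1(\mathscr{G})+(n_1-1)\operatorname{irr}(\mathscr{G})+(n_2-2)\operatorname{irr}(\mathscr{G}). \]
   Context: For a graph $G$: the first Zagreb index is $M_1(G)=\sum_{v\in V(G)}\deg(v)^2$; the Albertson index is $\operatorname{irr}(G)=\sum_{uv\in E(G)}|\deg_G(u)-\deg_G(v)|$; the Sigma index is $\sigma(G)=\sum_{uv\in E(G)}(\deg_G(u)-\deg_G(v))^2$. -}

module Defs where

open import Data.Nat using (ℕ; zero; suc; _+_; _*_; ∣_-_∣)
open import Data.Fin using (Fin; zero; suc)
open import Data.Bool using (Bool; true; false; if_then_else_)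

Σ : (n : ℕ) → (Fin n → ℕ) → ℕ
Σ zero    f = 0
Σ (suc n) f = f zero + Σ n (λ i → f (suc i))

-- A bipartite graph with bipartition sets X (size n₁) and Y (size n₂),
-- given by its biadjacency relation: the vertex set is X ⊎ Y and
-- x ∈ X, y ∈ Y are adjacent iff adj x y ≡ true; no edges inside X or Y.
record BipartiteGraph (n₁ n₂ : ℕ) : Set where
  field
    adj : Fin n₁ → Fin n₂ → Bool

module _ {n₁ n₂ : ℕ} (G : BipartiteGraph n₁ n₂) where
  open BipartiteGraph G

  [_] : Bool → ℕ
  [ true ]  = 1
  [ false ] = 0

  degX : Fin n₁ → ℕ
  degX x = Σ n₂ (λ y → [ adj x y ])

  degY : Fin n₂ → ℕ
  degY y = Σ n₁ (λ x → [ adj x y ])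

  ΣE : (Fin n₁ → Fin n₂ → ℕ) → ℕ
  ΣE f = Σ n₁ (λ x → Σ n₂ (λ y → if adj x y then f x y else 0))

  M₁ : ℕ
  M₁ = Σ n₁ (λ x → degX x * degX x) + Σ n₂ (λ y → degY y * degY y)

  irr : ℕ
  irr = ΣE (λ x y → ∣ degX x - degY y ∣)

  σ : ℕ
  σ = ΣE (λ x y → ∣ degX x - degY y ∣ * ∣ degX x - degY y ∣)

module Submission where

-- On an edge xy both degrees are positive, so t = |d(x) − d(y)| satisfies
-- t + 2 ≤ d(x) + d(y) ≤ n₁ + n₂, whence
-- t² + 3t ≤ (d(x) + d(y)) + (n₁ + n₂) t. Summing over the edges, and using that
-- the sum of d(x) + d(y) over the edges is M₁, gives
-- σ ≤ M₁ + (n₁ + n₂ − 3) irr, which is stronger than the claim.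

open import Defs
open import Data.Nat as ℕ using (ℕ; zero; suc; ∣_-_∣; z≤n)
open import Data.Integer using (ℤ; +_; _+_; _*_; _-_; _≤_; +≤+; -_)
open import Data.Nat.Properties as ℕ
  using (+-*-semiring; ≤-refl; ≤-trans; ≤-reflexive; +-mono-≤; +-monoʳ-≤; +-monoˡ-≤; *-monoˡ-≤;
         m≤m+n; m≤n⇒m≤o+n; m≤n+m; +-suc; +-comm; *-identityʳ; ∣m-n∣≤m⊔n; m⊔n≤m+n)
import Data.Integer.Properties as ℤ
open import Data.Fin using (Fin; zero; suc)
open import Data.Bool using (true; false; if_then_else_)
open import Function using (_∘_)
open import Relation.Binary.PropositionalEquality
  using (_≡_; refl; sym; trans; cong; cong₂; subst; module ≡-Reasoning)
open import Algebra.Properties.Semiring.Sum +-*-semiring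
  using (sum; sum-cong-≗; ∑-distrib-+; ∑-comm; *-distribˡ-sum; *-distribʳ-sum)
open import Data.Nat.Tactic.RingSolver using (solve-∀)
import Data.Integer.Tactic.RingSolver as ℤ-Solver

Σ≡sum : ∀ n (f : Fin n → ℕ) → Σ n f ≡ sum f
Σ≡sum zero    f = refl
Σ≡sum (suc n) f = cong (f zero ℕ.+_) (Σ≡sum n (f ∘ suc))

module _ (n : ℕ) where

  Σ-cong : {f g : Fin n → ℕ} → (∀ i → f i ≡ g i) → Σ n f ≡ Σ n g
  Σ-cong {f} {g} f≗g rewrite Σ≡sum n f | Σ≡sum n g = sum-cong-≗ f≗g

  Σ-distrib-+ : (f g : Fin n → ℕ) → Σ n (λ i → f i ℕ.+ g i) ≡ Σ n f ℕ.+ Σ n g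
  Σ-distrib-+ f g rewrite Σ≡sum n f | Σ≡sum n g | Σ≡sum n (λ i → f i ℕ.+ g i) =
    ∑-distrib-+ f g

  *-distribˡ-Σ : ∀ c (f : Fin n → ℕ) → c ℕ.* Σ n f ≡ Σ n (λ i → c ℕ.* f i)
  *-distribˡ-Σ c f rewrite Σ≡sum n f | Σ≡sum n (λ i → c ℕ.* f i) = *-distribˡ-sum c f

  *-distribʳ-Σ : ∀ c (f : Fin n → ℕ) → Σ n f ℕ.* c ≡ Σ n (λ i → f i ℕ.* c)
  *-distribʳ-Σ c f rewrite Σ≡sum n f | Σ≡sum n (λ i → f i ℕ.* c) = *-distribʳ-sum c f

Σ-comm : ∀ m n (f : Fin m → Fin n → ℕ) →
         Σ m (λ i → Σ n (f i)) ≡ Σ n (λ j → Σ m (λ i → f i j))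
Σ-comm m n f = begin
  Σ m (λ i → Σ n (f i))          ≡⟨ Σ-cong m (λ i → Σ≡sum n (f i)) ⟩
  Σ m (λ i → sum (f i))          ≡⟨ Σ≡sum m _ ⟩
  sum (λ i → sum (f i))          ≡⟨ ∑-comm f ⟩
  sum (λ j → sum (λ i → f i j))  ≡⟨ Σ≡sum n _ ⟨
  Σ n (λ j → sum (λ i → f i j))  ≡⟨ Σ-cong n (λ j → Σ≡sum m (λ i → f i j)) ⟨
  Σ n (λ j → Σ m (λ i → f i j))  ∎
  where open ≡-Reasoning

Σ-mono-≤ : ∀ n {f g : Fin n → ℕ} → (∀ i → f i ℕ.≤ g i) → Σ n f ℕ.≤ Σ n g
Σ-mono-≤ zero    f≤g = z≤n
Σ-mono-≤ (suc n) f≤g = +-mono-≤ (f≤g zero) (Σ-mono-≤ n (f≤g ∘ suc))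

Σ≤n*c : ∀ n {f : Fin n → ℕ} {c} → (∀ i → f i ℕ.≤ c) → Σ n f ℕ.≤ n ℕ.* c
Σ≤n*c zero    f≤c = z≤n
Σ≤n*c (suc n) f≤c = +-mono-≤ (f≤c zero) (Σ≤n*c n (f≤c ∘ suc))

term≤Σ : ∀ n (f : Fin n → ℕ) i → f i ℕ.≤ Σ n f
term≤Σ (suc n) f zero    = m≤m+n (f zero) _
term≤Σ (suc n) f (suc i) = m≤n⇒m≤o+n (f zero) (term≤Σ n (f ∘ suc) i)

2+∣m-n∣≤m+n : ∀ {m n} → 0 ℕ.< m → 0 ℕ.< n → 2 ℕ.+ ∣ m - n ∣ ℕ.≤ m ℕ.+ n
2+∣m-n∣≤m+n {suc m} {suc n} _ _ = begin
  2 ℕ.+ ∣ m - n ∣    ≤⟨ +-monoʳ-≤ 2 (≤-trans (∣m-n∣≤m⊔n m n) (m⊔n≤m+n m n)) ⟩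
  2 ℕ.+ (m ℕ.+ n)    ≡⟨ cong suc (+-suc m n) ⟨
  suc m ℕ.+ suc n    ∎
  where open ℕ.≤-Reasoning

m*m+3*m≤n+o*m : ∀ {m n o} → 2 ℕ.+ m ℕ.≤ n → n ℕ.≤ o → m ℕ.* m ℕ.+ 3 ℕ.* m ℕ.≤ n ℕ.+ o ℕ.* m
m*m+3*m≤n+o*m {m} {n} {o} 2+m≤n n≤o = begin
  m ℕ.* m ℕ.+ 3 ℕ.* m      ≡⟨ rearrange m ⟩
  m ℕ.+ (2 ℕ.+ m) ℕ.* m    ≤⟨ +-mono-≤ (≤-trans (m≤n+m m 2) 2+m≤n) (*-monoˡ-≤ m (≤-trans 2+m≤n n≤o)) ⟩
  n ℕ.+ o ℕ.* m            ∎
  where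
  open ℕ.≤-Reasoning
  rearrange : ∀ m → m ℕ.* m ℕ.+ 3 ℕ.* m ≡ m ℕ.+ (2 ℕ.+ m) ℕ.* m
  rearrange = solve-∀

-- The hypothesis has 3 irr moved to the left so that no truncated subtraction occurs in ℕ.
ℕ-bound⇒ℤ-bound : ∀ s i m a b → s ℕ.+ 3 ℕ.* i ℕ.≤ 2 ℕ.* m ℕ.+ (a ℕ.+ b) ℕ.* i →
                  + s ≤ + 2 * + m + (+ a - + 1) * + i + (+ b - + 2) * + i
ℕ-bound⇒ℤ-bound s i m a b bound = begin
  + s                                                ≡⟨ cancel (+ s) (+ i) ⟨
  + s + + 3 * + i - + 3 * + i                        ≡⟨ cong (λ k → + s + k - + 3 * + i) (ℤ.pos-* 3 i) ⟨
  + (s ℕ.+ 3 ℕ.* i) - + 3 * + i                      ≤⟨ ℤ.+-monoˡ-≤ (- (+ 3 * + i)) (+≤+ bound) ⟩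
  + (2 ℕ.* m ℕ.+ (a ℕ.+ b) ℕ.* i) - + 3 * + i        ≡⟨ cong (_- + 3 * + i) (cong₂ _+_ (ℤ.pos-* 2 m) (ℤ.pos-* (a ℕ.+ b) i)) ⟩
  + 2 * + m + (+ a + + b) * + i - + 3 * + i          ≡⟨ regroup (+ m) (+ i) (+ a) (+ b) ⟩
  + 2 * + m + (+ a - + 1) * + i + (+ b - + 2) * + i  ∎
  where
  open ℤ.≤-Reasoning
  cancel : ∀ (s i : ℤ) → s + + 3 * i - + 3 * i ≡ s
  cancel = ℤ-Solver.solve-∀
  regroup : ∀ (m i a b : ℤ) → + 2 * m + (a + b) * i - + 3 * i ≡ + 2 * m + (a - + 1) * i + (b - + 2) * i
  regroup = ℤ-Solver.solve-∀

if-0-distrib-+ : ∀ b {c d : ℕ} →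
                 (if b then c ℕ.+ d else 0) ≡ (if b then c else 0) ℕ.+ (if b then d else 0)
if-0-distrib-+ true  = refl
if-0-distrib-+ false = refl

if-0-distrib-* : ∀ b k {c : ℕ} → (if b then k ℕ.* c else 0) ≡ k ℕ.* (if b then c else 0)
if-0-distrib-* true  k = refl
if-0-distrib-* false k = sym (ℕ.*-zeroʳ k)

module _ {n₁ n₂ : ℕ} (G : BipartiteGraph n₁ n₂) where
  open BipartiteGraph G

  if-0≡[]* : ∀ b {c : ℕ} → (if b then c else 0) ≡ [_] G b ℕ.* c
  if-0≡[]* true  = sym (ℕ.+-identityʳ _)
  if-0≡[]* false = refl

  []≤1 : ∀ b → [_] G b ℕ.≤ 1
  []≤1 true  = ≤-refl
  []≤1 false = z≤n

  degX≤n₂ : ∀ x → degX G x ℕ.≤ n₂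
  degX≤n₂ x = ≤-trans (Σ≤n*c n₂ (λ y → []≤1 (adj x y))) (≤-reflexive (*-identityʳ n₂))

  degY≤n₁ : ∀ y → degY G y ℕ.≤ n₁
  degY≤n₁ y = ≤-trans (Σ≤n*c n₁ (λ x → []≤1 (adj x y))) (≤-reflexive (*-identityʳ n₁))

  adj⇒0<degX : ∀ {x y} → adj x y ≡ true → 0 ℕ.< degX G x
  adj⇒0<degX {x} {y} xy = subst (λ b → [_] G b ℕ.≤ degX G x) xy (term≤Σ n₂ _ y)

  adj⇒0<degY : ∀ {x y} → adj x y ≡ true → 0 ℕ.< degY G y
  adj⇒0<degY {x} {y} xy = subst (λ b → [_] G b ℕ.≤ degY G y) xy (term≤Σ n₁ _ x)

  Σ-if-adjˡ : ∀ x c → Σ n₂ (λ y → if adj x y then c else 0) ≡ degX G x ℕ.* c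
  Σ-if-adjˡ x c = trans (Σ-cong n₂ (λ y → if-0≡[]* (adj x y))) (sym (*-distribʳ-Σ n₂ c _))

  Σ-if-adjʳ : ∀ y c → Σ n₁ (λ x → if adj x y then c else 0) ≡ degY G y ℕ.* c
  Σ-if-adjʳ y c = trans (Σ-cong n₁ (λ x → if-0≡[]* (adj x y))) (sym (*-distribʳ-Σ n₁ c _))

  ΣE-mono-≤ : {f g : Fin n₁ → Fin n₂ → ℕ} →
              (∀ x y → adj x y ≡ true → f x y ℕ.≤ g x y) → ΣE G f ℕ.≤ ΣE G g
  ΣE-mono-≤ {f} {g} f≤g = Σ-mono-≤ n₁ (λ x → Σ-mono-≤ n₂ (λ y → on-edge x y))
    where
    on-edge : ∀ x y → (if adj x y then f x y else 0) ℕ.≤ (if adj x y then g x y else 0)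
    on-edge x y with adj x y in xy
    ... | true  = f≤g x y xy
    ... | false = z≤n

  ΣE-distrib-+ : (f g : Fin n₁ → Fin n₂ → ℕ) →
                 ΣE G (λ x y → f x y ℕ.+ g x y) ≡ ΣE G f ℕ.+ ΣE G g
  ΣE-distrib-+ f g = begin
    ΣE G (λ x y → f x y ℕ.+ g x y)
      ≡⟨ Σ-cong n₁ (λ x → Σ-cong n₂ (λ y → if-0-distrib-+ (adj x y))) ⟩
    Σ n₁ (λ x → Σ n₂ (λ y → (if adj x y then f x y else 0) ℕ.+ (if adj x y then g x y else 0)))
      ≡⟨ Σ-cong n₁ (λ x → Σ-distrib-+ n₂ _ _) ⟩
    Σ n₁ (λ x → Σ n₂ (λ y → if adj x y then f x y else 0) ℕ.+ Σ n₂ (λ y → if adj x y then g x y else 0))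
      ≡⟨ Σ-distrib-+ n₁ _ _ ⟩
    ΣE G f ℕ.+ ΣE G g
      ∎
    where open ≡-Reasoning

  ΣE-*-distribˡ : ∀ k (f : Fin n₁ → Fin n₂ → ℕ) → ΣE G (λ x y → k ℕ.* f x y) ≡ k ℕ.* ΣE G f
  ΣE-*-distribˡ k f = begin
    ΣE G (λ x y → k ℕ.* f x y)                                      ≡⟨ Σ-cong n₁ (λ x → Σ-cong n₂ (λ y → if-0-distrib-* (adj x y) k)) ⟩
    Σ n₁ (λ x → Σ n₂ (λ y → k ℕ.* (if adj x y then f x y else 0))) ≡⟨ Σ-cong n₁ (λ x → *-distribˡ-Σ n₂ k _) ⟨
    Σ n₁ (λ x → k ℕ.* Σ n₂ (λ y → if adj x y then f x y else 0))   ≡⟨ *-distribˡ-Σ n₁ k _ ⟨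
    k ℕ.* ΣE G f                                                    ∎
    where open ≡-Reasoning

  ΣE-degree-sum≡M₁ : ΣE G (λ x y → degX G x ℕ.+ degY G y) ≡ M₁ G
  ΣE-degree-sum≡M₁ = trans (ΣE-distrib-+ _ _) (cong₂ ℕ._+_ ΣE-degX ΣE-degY)
    where
    ΣE-degX : ΣE G (λ x y → degX G x) ≡ Σ n₁ (λ x → degX G x ℕ.* degX G x)
    ΣE-degX = Σ-cong n₁ (λ x → Σ-if-adjˡ x (degX G x))
    ΣE-degY : ΣE G (λ x y → degY G y) ≡ Σ n₂ (λ y → degY G y ℕ.* degY G y)
    ΣE-degY = trans (Σ-comm n₁ n₂ _) (Σ-cong n₂ (λ y → Σ-if-adjʳ y (degY G y)))

  σ+3*irr≤M₁+n*irr : σ G ℕ.+ 3 ℕ.* irr G ℕ.≤ M₁ G ℕ.+ (n₁ ℕ.+ n₂) ℕ.* irr G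
  σ+3*irr≤M₁+n*irr = begin
    σ G ℕ.+ 3 ℕ.* irr G                   ≡⟨ cong (σ G ℕ.+_) (ΣE-*-distribˡ 3 t) ⟨
    σ G ℕ.+ ΣE G (λ x y → 3 ℕ.* t x y)    ≡⟨ ΣE-distrib-+ (λ x y → t x y ℕ.* t x y) _ ⟨
    ΣE G (λ x y → t x y ℕ.* t x y ℕ.+ 3 ℕ.* t x y)
                                          ≤⟨ ΣE-mono-≤ edge-bound ⟩
    ΣE G (λ x y → s x y ℕ.+ N ℕ.* t x y)  ≡⟨ ΣE-distrib-+ s _ ⟩
    ΣE G s ℕ.+ ΣE G (λ x y → N ℕ.* t x y) ≡⟨ cong₂ ℕ._+_ ΣE-degree-sum≡M₁ (ΣE-*-distribˡ N t) ⟩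
    M₁ G ℕ.+ N ℕ.* irr G                  ∎
    where
    open ℕ.≤-Reasoning
    N : ℕ
    N = n₁ ℕ.+ n₂
    t s : Fin n₁ → Fin n₂ → ℕ
    t x y = ∣ degX G x - degY G y ∣
    s x y = degX G x ℕ.+ degY G y
    edge-bound : ∀ x y → adj x y ≡ true → t x y ℕ.* t x y ℕ.+ 3 ℕ.* t x y ℕ.≤ s x y ℕ.+ N ℕ.* t x y
    edge-bound x y xy = m*m+3*m≤n+o*m
      (2+∣m-n∣≤m+n (adj⇒0<degX xy) (adj⇒0<degY xy))
      (≤-trans (+-mono-≤ (degX≤n₂ x) (degY≤n₁ y)) (≤-reflexive (+-comm n₂ n₁)))

lemma4p7 : (n₁ n₂ : ℕ) (G : BipartiteGraph n₁ n₂) →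
    + σ G ≤ (+ 2) * (+ M₁ G) + (+ n₁ - + 1) * (+ irr G) + (+ n₂ - + 2) * (+ irr G)
lemma4p7 n₁ n₂ G = ℕ-bound⇒ℤ-bound (σ G) (irr G) (M₁ G) n₁ n₂
  (≤-trans (σ+3*irr≤M₁+n*irr G) (+-monoˡ-≤ _ (ℕ.m≤n*m (M₁ G) 2)))
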